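{- Let $n\ge 1$ and $\pi\in\mathcal D^1_{2n}(2413,3142)$ with last entry $2k-1$, decomposed into blocks $\pi=\cdots A_i B_i\cdots A_1 B_0\,(2k)\,A_0\,(2k-1)$ as described in the context. Then every block $A_i$ ($i\ge0$) and every block $B_j$ ($j\ge0$) has even length.
   Context: A Dumont permutation of the first kind of length $2n$ is a permutation $\pi$ of $\{1,\dots,2n\}$ such that every even entry is not last and is followed by a smaller entry, and every odd entry is either last or followed by a larger entry. $\mathcal D^1_{2n}(2413,3142)$ is the set of those containing no subsequence order-isomorphic to $2413$ or $3142$. Block decomposition: if the last entry is $2k-1$, let $A_0$ be the (possibly empty) string of entries strictly between $2k$ and the last entry. The prefix of $\pi$ preceding $2k$ consists of entries each either $<2k-1$ or $>2k$; split it into maximal runs of consecutive entries all $<2k-1$ or all $>2k$. If the run immediately preceding $2k$ consists of entries $>2k$ it is $B_0$, otherwise $B_0$ is empty; moving leftwards the remaining runs alternate and are named $A_1,B_1,A_2,B_2,\dots$, where the $A_i$ ($i\ge1$) consist of entries $<2k-1$ and the $B_i$ of entries $>2k$. -}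

module Defs where

open import Data.Nat using (ℕ; zero; suc; _+_; _*_; _∸_; _<_; _<ᵇ_)
open import Data.Nat.Divisibility using (_∣_)
open import Data.Bool using (Bool; true; false; if_then_else_)
open import Data.List using (List; []; _∷_; _++_; [_]; map; upTo; length)
open import Data.List.Relation.Binary.Sublist.Propositional using (_⊆_)
open import Data.List.Relation.Binary.Permutation.Propositional using (_↭_)
open import Data.Product using (_×_; ∃-syntax)
open import Data.Unit using (⊤)
open import Relation.Nullary using (¬_)

Even : ℕ → Set
Even m = 2 ∣ m

Odd : ℕ → Set
Odd m = ¬ (2 ∣ m)

-- π is a permutation of {1, …, 2n} (given as the list of its entries π(1) … π(2n)).
IsPerm : ℕ → List ℕ → Set
IsPerm m π = π ↭ map suc (upTo m)

DumontCond : List ℕ → Set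
DumontCond [] = ⊤
DumontCond (x ∷ []) = Odd x
DumontCond (x ∷ y ∷ ys) =
  ((Even x → y < x) × (Odd x → x < y)) × DumontCond (y ∷ ys)

Dumont1 : ℕ → List ℕ → Set
Dumont1 n π = IsPerm (2 * n) π × DumontCond π

Contains2413 : List ℕ → Set
Contains2413 π = ∃[ a ] ∃[ b ] ∃[ c ] ∃[ d ]
  ((a ∷ b ∷ c ∷ d ∷ []) ⊆ π × c < a × a < d × d < b)

Contains3142 : List ℕ → Set
Contains3142 π = ∃[ a ] ∃[ b ] ∃[ c ] ∃[ d ]
  ((a ∷ b ∷ c ∷ d ∷ []) ⊆ π × b < d × d < a × a < c)

InD : ℕ → List ℕ → Set
InD n π = Dumont1 n π × ¬ Contains2413 π × ¬ Contains3142 π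

runsGo : (ℕ → Bool) → Bool → List ℕ → List ℕ → List (List ℕ)
runsGo p b cur [] = cur ∷ []
runsGo p b cur (y ∷ ys) with p y
runsGo p true  cur (y ∷ ys) | true  = runsGo p true (cur ++ [ y ]) ys
runsGo p false cur (y ∷ ys) | false = runsGo p false (cur ++ [ y ]) ys
runsGo p true  cur (y ∷ ys) | false = cur ∷ runsGo p false [ y ] ys
runsGo p false cur (y ∷ ys) | true  = cur ∷ runsGo p true [ y ] ys

runs : (ℕ → Bool) → List ℕ → List (List ℕ)
runs p [] = []
runs p (x ∷ xs) = runsGo p (p x) [ x ] xs

-- The blocks A_i (i ≥ 1) and B_j (j ≥ 0, B_0 only if nonempty) of the prefix
-- preceding 2k: the maximal runs of entries all < 2k-1 or all > 2k.
prefixBlocks : ℕ → List ℕ → List (List ℕ)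
prefixBlocks k P = runs (λ x → x <ᵇ 2 * k ∸ 1) P

{-# OPTIONS --safe #-}
module Submission where

-- Each block R is an interval of values: if a + 1 and d are its least and greatest
-- entries, no entry outside R lies in (a, d].  For a block of entries below 2k−1, an
-- entry of that range to its left or right would form a 2413 together with the
-- adjacent entry above 2k−1 and the final 2k−1; for a block above 2k, it would form a
-- 3142 with the adjacent entry below 2k−1 and the entry 2k.  Counting the entries
-- ≤ d and ≤ a of a permutation of {1, …, 2n} then gives |R| = d − a.  The Dumont
-- condition fixes the parities of a and d: after a block below 2k−1 every entry is
-- larger than d, so its minimum a + 1 and the entry d + 1 (which lies further right)
-- are followed only by larger entries and are odd; after a block above 2k every entry
-- is smaller than a + 1, so its maximum d and the entry a (further right, but not
-- last) are followed only by smaller entries and are even.  Hence |R| is even.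
-- A₀ is a block below 2k−1: its first entry follows the even entry 2k, and a later
-- entry above 2k would complete a 3142 with 2k, that first entry and the final 2k−1.

open import Defs
open import Data.Bool using (Bool; true; false; not)
open import Data.Bool.Properties using (not-involutive)
open import Data.Empty using (⊥-elim)
open import Data.List using (List; []; _∷_; _++_; [_]; length; filter; map; upTo)
open import Data.List.Extrema.Nat using (min; max; argmin-sel; argmax-sel; min≤⊤; min≤xs; ⊥≤max; xs≤max)
open import Data.List.Membership.Propositional using (_∈_)
open import Data.List.Membership.Propositional.Properties using (∈-map⁺; ∈-upTo⁺; ∈-++⁺ˡ; ∈-++⁺ʳ; ∈-++⁻; ∈-∃++)
open import Data.List.Properties
  using (++-assoc; ++-identityʳ; map-++; upTo-∷ʳ; length-map; length-upTo; length-++;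
         filter-++; filter-all; filter-none; filter-accept; filter-reject; filter-some)
open import Data.List.Relation.Binary.Permutation.Propositional using (↭-sym)
open import Data.List.Relation.Binary.Permutation.Propositional.Properties using (All-resp-↭; ∈-resp-↭; ↭-length; filter-↭)
open import Data.List.Relation.Binary.Sublist.Propositional.Properties using (++⁺)
open import Data.List.Relation.Unary.All as All using (All; []; _∷_)
open import Data.List.Relation.Unary.All.Properties using (all-upTo; ++⁻ˡ; ++⁻ʳ) renaming (++⁺ to All-++⁺; map⁺ to All-map⁺)
open import Data.List.Relation.Unary.Any as Any using (here; there)
open import Data.Nat using (ℕ; zero; suc; _+_; _*_; _∸_; _≤_; _<_; _≤?_; _<?_; _<ᵇ_; s≤s; z≤n; z<s)
open import Data.List.Relation.Binary.Sublist.Propositional {A = ℕ} using (_⊆_; from∈)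
open import Data.Nat.Divisibility using (_∣?_; ∣m+n∣m⇒∣n; ∣m∣n⇒∣m+n; ∣-refl; divides)
open import Data.Nat.Properties
open import Data.Product using (_×_; _,_; proj₁; proj₂; ∃₂)
open import Data.Sum using (_⊎_; inj₁; inj₂)
open import Data.Unit using (tt)
open import Function using (id; _∘_)
open import Relation.Binary.Definitions using (tri<; tri≈; tri>)
open import Relation.Binary.PropositionalEquality
  using (_≡_; _≢_; refl; sym; trans; cong; cong₂; subst; ≢-sym; module ≡-Reasoning)
open import Relation.Nullary using (¬_; yes; no)
open import Relation.Nullary.Decidable using (_×-dec_; decidable-stable)
open import Relation.Nullary.Reflects using (Reflects; invert)
open import Relation.Unary using (Decidable; ∁)

even-or-even-suc : ∀ m → Even m ⊎ Even (suc m)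
even-or-even-suc zero = inj₁ (divides 0 refl)
even-or-even-suc (suc m) with even-or-even-suc m
... | inj₁ even-m = inj₂ (∣m∣n⇒∣m+n ∣-refl even-m)
... | inj₂ even-sm = inj₁ even-sm

odd-suc⇒even : ∀ {m} → Odd (suc m) → Even m
odd-suc⇒even {m} odd-sm with even-or-even-suc m
... | inj₁ even-m = even-m
... | inj₂ even-sm = ⊥-elim (odd-sm even-sm)

¬odd⇒even : ∀ {m} → ¬ Odd m → Even m
¬odd⇒even {m} = decidable-stable (2 ∣? m)

even-difference : ∀ {a d l} → Even a → Even d → a + l ≡ d → Even l
even-difference even-a even-d a+l≡d = ∣m+n∣m⇒∣n (subst Even (sym a+l≡d) even-d) even-a

≢⇒<⊎> : ∀ {x y} → x ≢ y → x < y ⊎ y < x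
≢⇒<⊎> {x} {y} x≢y with <-cmp x y
... | tri< x<y _ _ = inj₁ x<y
... | tri≈ _ x≡y _ = ⊥-elim (x≢y x≡y)
... | tri> _ _ y<x = inj₂ y<x

<ᵇ-true : ∀ {x y} → (x <ᵇ y) ≡ true → x < y
<ᵇ-true {x} {y} e = invert (subst (Reflects (x < y)) e (<ᵇ-reflects-< x y))

<ᵇ-false : ∀ {x y} → (x <ᵇ y) ≡ false → ¬ x < y
<ᵇ-false {x} {y} e = invert (subst (Reflects (x < y)) e (<ᵇ-reflects-< x y))

Between : ℕ → ℕ → ℕ → Set
Between a d x = a < x × x ≤ d

between? : ∀ a d → Decidable (Between a d)
between? a d x = (a <? x) ×-dec (x ≤? d)

count-≤-split : ∀ {a d} → a ≤ d → ∀ xs →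
  length (filter (_≤? d) xs) ≡ length (filter (_≤? a) xs) + length (filter (between? a d) xs)
count-≤-split a≤d [] = refl
count-≤-split {a} {d} a≤d (x ∷ xs) with x ≤? a | count-≤-split a≤d xs
... | yes x≤a | ih
  rewrite filter-accept (_≤? d) {xs = xs} (≤-trans x≤a a≤d)
        | filter-accept (_≤? a) {xs = xs} x≤a
        | filter-reject (between? a d) {xs = xs} (λ (a<x , _) → <⇒≱ a<x x≤a) = cong suc ih
... | no x≰a | ih with x ≤? d
...   | yes x≤d
  rewrite filter-accept (_≤? d) {xs = xs} x≤d
        | filter-reject (_≤? a) {xs = xs} x≰a
        | filter-accept (between? a d) {xs = xs} (≰⇒> x≰a , x≤d) = trans (cong suc ih) (sym (+-suc _ _))
...   | no x≰d
  rewrite filter-reject (_≤? d) {xs = xs} x≰d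
        | filter-reject (_≤? a) {xs = xs} x≰a
        | filter-reject (between? a d) {xs = xs} (λ (_ , x≤d) → x≰d x≤d) = ih

extremes : ∀ r R → ∃₂ λ c d → c ∈ r ∷ R × d ∈ r ∷ R × All (λ x → c ≤ x × x ≤ d) (r ∷ R)
extremes r R = min r R , max r R , selected (argmin-sel id r R) , selected (argmax-sel id r R) ,
  All.zip (min≤⊤ r R ∷ min≤xs r R , ⊥≤max r R ∷ xs≤max r R)
  where
  selected : ∀ {m} → m ≡ r ⊎ m ∈ R → m ∈ r ∷ R
  selected (inj₁ refl) = here refl
  selected (inj₂ m∈R) = there m∈R

split-at : ∀ {P : ℕ → Set} {R x} → All P R → x ∈ R → ∃₂ λ R₁ R₂ → R ≡ R₁ ++ x ∷ R₂ × All P R₂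
split-at all-R x∈R with R₁ , R₂ , refl ← ∈-∃++ x∈R = R₁ , R₂ , refl , All.tail (++⁻ʳ R₁ all-R)

four-segments-⊆ : ∀ {L} X₁ X₂ X₃ X₄ {a b c d : ℕ} → L ≡ X₁ ++ X₂ ++ X₃ ++ X₄ →
  a ∈ X₁ → b ∈ X₂ → c ∈ X₃ → d ∈ X₄ → (a ∷ b ∷ c ∷ d ∷ []) ⊆ L
four-segments-⊆ X₁ X₂ X₃ X₄ L≡ a∈ b∈ c∈ d∈ =
  subst (_ ⊆_) (sym L≡) (++⁺ (from∈ a∈) (++⁺ (from∈ b∈) (++⁺ (from∈ c∈) (from∈ d∈))))

LastSatisfies : (ℕ → Set) → List ℕ → Set
LastSatisfies Q U = U ≡ [] ⊎ ∃₂ λ U′ u → U ≡ U′ ++ [ u ] × Q u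

HeadSatisfies : (ℕ → Set) → List ℕ → Set
HeadSatisfies Q V = V ≡ [] ⊎ ∃₂ λ v V′ → V ≡ v ∷ V′ × Q v

LastSatisfies-map : ∀ {Q Q′ : ℕ → Set} {U} → (∀ {u} → u ∈ U → Q u → Q′ u) → LastSatisfies Q U → LastSatisfies Q′ U
LastSatisfies-map f (inj₁ U≡[]) = inj₁ U≡[]
LastSatisfies-map f (inj₂ (U′ , u , refl , qu)) = inj₂ (U′ , u , refl , f (∈-++⁺ʳ U′ (here refl)) qu)

HeadSatisfies-map : ∀ {Q Q′ : ℕ → Set} {V} → (∀ {v} → v ∈ V → Q v → Q′ v) → HeadSatisfies Q V → HeadSatisfies Q′ V
HeadSatisfies-map f (inj₁ V≡[]) = inj₁ V≡[]
HeadSatisfies-map f (inj₂ (v , V′ , refl , qv)) = inj₂ (v , V′ , refl , f (here refl) qv)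

HeadSatisfies-++ : ∀ {Q : ℕ → Set} {V e} L → HeadSatisfies Q V → Q e → HeadSatisfies Q (V ++ e ∷ L)
HeadSatisfies-++ {e = e} L (inj₁ refl) qe = inj₂ (e , L , refl , qe)
HeadSatisfies-++ {e = e} L (inj₂ (v , V′ , refl , qv)) _ = inj₂ (v , V′ ++ e ∷ L , refl , qv)

last-of-nonempty : ∀ {Q : ℕ → Set} U {x} xs → All Q (x ∷ xs) → ∃₂ λ U′ u → U ++ x ∷ xs ≡ U′ ++ [ u ] × Q u
last-of-nonempty U [] (qx ∷ []) = U , _ , refl , qx
last-of-nonempty U {x} (y ∷ ys) (_ ∷ qys) with last-of-nonempty (U ++ [ x ]) ys qys
... | U′ , u , eq , qu = U′ , u , trans (sym (++-assoc U [ x ] (y ∷ ys))) eq , qu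

record Run (p : ℕ → Bool) (P R : List ℕ) : Set where
  constructor run
  field
    class : Bool
    before after : List ℕ
    split : P ≡ before ++ R ++ after
    uniform : All (λ x → p x ≡ class) R
    maximalˡ : LastSatisfies (λ x → p x ≡ not class) before
    maximalʳ : HeadSatisfies (λ x → p x ≡ not class) after

≡-or-≡not : ∀ x b → x ≡ b ⊎ x ≡ not b
≡-or-≡not false false = inj₁ refl
≡-or-≡not false true = inj₂ refl
≡-or-≡not true false = inj₂ refl
≡-or-≡not true true = inj₁ refl

runsGo-extend : ∀ p {b} cur {y} ys → p y ≡ b → runsGo p b cur (y ∷ ys) ≡ runsGo p b (cur ++ [ y ]) ys
runsGo-extend p {false} cur ys py rewrite py = refl
runsGo-extend p {true} cur ys py rewrite py = refl

runsGo-break : ∀ p {b} cur {y} ys → p y ≡ not b → runsGo p b cur (y ∷ ys) ≡ cur ∷ runsGo p (not b) [ y ] ys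
runsGo-break p {false} cur ys py rewrite py = refl
runsGo-break p {true} cur ys py rewrite py = refl

runsGo-Run : ∀ p {P} b U c cur ys → P ≡ U ++ (c ∷ cur) ++ ys → All (λ x → p x ≡ b) (c ∷ cur) →
  LastSatisfies (λ x → p x ≡ not b) U → All (Run p P) (runsGo p b (c ∷ cur) ys)
runsGo-Run p b U c cur [] split uniform maximalˡ = run b U [] split uniform maximalˡ (inj₁ refl) ∷ []
runsGo-Run p b U c cur (y ∷ ys) split uniform maximalˡ with ≡-or-≡not (p y) b
... | inj₁ py rewrite runsGo-extend p (c ∷ cur) ys py =
  runsGo-Run p b U c (cur ++ [ y ]) ys
    (trans split (cong (U ++_) (sym (++-assoc (c ∷ cur) [ y ] ys))))
    (All-++⁺ uniform (py ∷ [])) maximalˡ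
... | inj₂ py rewrite runsGo-break p (c ∷ cur) ys py =
  run b U (y ∷ ys) split uniform maximalˡ (inj₂ (y , ys , refl , py)) ∷
  runsGo-Run p (not b) (U ++ c ∷ cur) y [] ys
    (trans split (sym (++-assoc U (c ∷ cur) (y ∷ ys))))
    (py ∷ [])
    (inj₂ (last-of-nonempty U cur (All.map (λ pz → trans pz (sym (not-involutive b))) uniform)))

runs-Run : ∀ p P → All (Run p P) (runs p P)
runs-Run p [] = []
runs-Run p (x ∷ xs) = runsGo-Run p (p x) [] x [] xs refl (refl ∷ []) (inj₁ refl)

DumontCond-∷⁻ : ∀ {x xs} → DumontCond (x ∷ xs) → DumontCond xs
DumontCond-∷⁻ {xs = []} _ = tt
DumontCond-∷⁻ {xs = _ ∷ _} (_ , dumont) = dumont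

dumont-step : ∀ X {x y Y} → DumontCond (X ++ x ∷ y ∷ Y) → (Even x → y < x) × (Odd x → x < y)
dumont-step [] = proj₁
dumont-step (_ ∷ X) dumont = dumont-step X (DumontCond-∷⁻ dumont)

dumont-last : ∀ X {x} → DumontCond (X ++ [ x ]) → Odd x
dumont-last [] odd-x = odd-x
dumont-last (_ ∷ X) dumont = dumont-last X (DumontCond-∷⁻ dumont)

odd-if-followed-by-larger : ∀ X {x T} → DumontCond (X ++ x ∷ T) → All (x ≤_) T → Odd x
odd-if-followed-by-larger X {T = []} dumont [] = dumont-last X dumont
odd-if-followed-by-larger X {T = _ ∷ _} dumont (x≤y ∷ _) even-x =
  <⇒≱ (proj₁ (dumont-step X dumont) even-x) x≤y

even-if-followed-by-smaller : ∀ X {x y} T → DumontCond (X ++ x ∷ T ++ [ y ]) →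
  All (_≤ x) T → y ≤ x → Even x
even-if-followed-by-smaller X [] dumont [] y≤x =
  ¬odd⇒even λ odd-x → <⇒≱ (proj₂ (dumont-step X dumont) odd-x) y≤x
even-if-followed-by-smaller X (_ ∷ _) dumont (t≤x ∷ _) _ =
  ¬odd⇒even λ odd-x → <⇒≱ (proj₂ (dumont-step X dumont) odd-x) t≤x

suc-upTo-bounded : ∀ N → All (Between 0 N) (map suc (upTo N))
suc-upTo-bounded N = All-map⁺ (All.map (z<s ,_) (all-upTo N))

suc-upTo-count-≤ : ∀ N {t} → t ≤ N → length (filter (_≤? t) (map suc (upTo N))) ≡ t
suc-upTo-count-≤ N t≤N with m≤n⇒m<n∨m≡n t≤N
... | inj₂ refl = trans (cong length (filter-all (_≤? N) (All.map (λ (_ , x≤N) → x≤N) (suc-upTo-bounded N))))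
                        (trans (length-map suc (upTo N)) (length-upTo N))
suc-upTo-count-≤ (suc N) {t} _ | inj₁ (s≤s t≤N) = begin
  length (filter (_≤? t) (map suc (upTo (suc N))))
    ≡⟨ cong (length ∘ filter (_≤? t)) (trans (cong (map suc) (sym (upTo-∷ʳ N))) (map-++ suc (upTo N) [ N ])) ⟩
  length (filter (_≤? t) (map suc (upTo N) ++ [ suc N ]))
    ≡⟨ cong length (filter-++ (_≤? t) (map suc (upTo N)) [ suc N ]) ⟩
  length (filter (_≤? t) (map suc (upTo N)) ++ filter (_≤? t) [ suc N ])
    ≡⟨ cong (λ l → length (filter (_≤? t) (map suc (upTo N)) ++ l)) (filter-reject (_≤? t) {xs = []} (<⇒≱ (s≤s t≤N))) ⟩
  length (filter (_≤? t) (map suc (upTo N)) ++ [])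
    ≡⟨ cong length (++-identityʳ (filter (_≤? t) (map suc (upTo N)))) ⟩
  length (filter (_≤? t) (map suc (upTo N)))
    ≡⟨ suc-upTo-count-≤ N t≤N ⟩
  t ∎
  where open ≡-Reasoning

module Permutation {N π} (perm : IsPerm N π) where

  entries-bounded : All (Between 0 N) π
  entries-bounded = All-resp-↭ (↭-sym perm) (suc-upTo-bounded N)

  ∈-bounded : ∀ U {R x} → π ≡ U ++ R → x ∈ R → Between 0 N x
  ∈-bounded U π≡UR x∈R = All.lookup entries-bounded (subst (_ ∈_) (sym π≡UR) (∈-++⁺ʳ U x∈R))

  entry-∈ : ∀ {v} → 0 < v → v ≤ N → v ∈ π
  entry-∈ {suc w} _ w<N = ∈-resp-↭ (↭-sym perm) (∈-map⁺ suc (∈-upTo⁺ w<N))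

  count-≤ : ∀ {t} → t ≤ N → length (filter (_≤? t) π) ≡ t
  count-≤ t≤N = trans (↭-length (filter-↭ (_≤? _) perm)) (suc-upTo-count-≤ N t≤N)

  count-between : ∀ {a d} → a ≤ d → d ≤ N → a + length (filter (between? a d) π) ≡ d
  count-between {a} {d} a≤d d≤N = begin
    a + length (filter (between? a d) π)                        ≡⟨ cong (_+ length (filter (between? a d) π)) (count-≤ (≤-trans a≤d d≤N)) ⟨
    length (filter (_≤? a) π) + length (filter (between? a d) π) ≡⟨ count-≤-split a≤d π ⟨
    length (filter (_≤? d) π)                                   ≡⟨ count-≤ d≤N ⟩
    d ∎
    where open ≡-Reasoning

  -- An entry occurring twice would give two entries in (x − 1, x], which holds exactly one.
  entries-distinct : ∀ {X Y x y} → π ≡ X ++ Y → x ∈ X → y ∈ Y → x ≢ y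
  entries-distinct {X} {Y} {x} π≡X++Y x∈X y∈Y x≡y
    with All.lookup entries-bounded (subst (x ∈_) (sym π≡X++Y) (∈-++⁺ˡ x∈X))
  entries-distinct {X} {Y} {suc w} π≡X++Y x∈X y∈Y refl | _ , suc-w≤N = <-irrefl refl (begin-strict
    1                                                  <⟨ +-mono-≤ (filter-some P? (Any.map self x∈X)) (filter-some P? (Any.map self y∈Y)) ⟩
    length (filter P? X) + length (filter P? Y)        ≡⟨ length-++ (filter P? X) ⟨
    length (filter P? X ++ filter P? Y)               ≡⟨ cong length (filter-++ P? X Y) ⟨
    length (filter P? (X ++ Y))                       ≡⟨ cong (length ∘ filter P?) π≡X++Y ⟨
    length (filter P? π)                              ≡⟨ +-cancelˡ-≡ w _ 1 (trans (count-between (n≤1+n w) suc-w≤N) (+-comm 1 w)) ⟩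
    1 ∎)
    where
    open ≤-Reasoning
    P? = between? w (suc w)
    self : ∀ {z} → suc w ≡ z → Between w (suc w) z
    self refl = ≤-refl , ≤-refl

  block-length : ∀ {U R Z a d} → π ≡ U ++ R ++ Z → All (Between a d) R →
    All (∁ (Between a d)) U → All (∁ (Between a d)) Z → a ≤ d → d ≤ N → a + length R ≡ d
  block-length {U} {R} {Z} {a} {d} π≡URZ in-R out-U out-Z a≤d d≤N =
    trans (cong (λ l → a + length l) (sym filtered)) (count-between a≤d d≤N)
    where
    open ≡-Reasoning
    P? = between? a d
    filtered : filter P? π ≡ R
    filtered = begin
      filter P? π                           ≡⟨ cong (filter P?) π≡URZ ⟩
      filter P? (U ++ R ++ Z)               ≡⟨ filter-++ P? U (R ++ Z) ⟩
      filter P? U ++ filter P? (R ++ Z)     ≡⟨ cong₂ _++_ (filter-none P? out-U) (filter-++ P? R Z) ⟩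
      filter P? R ++ filter P? Z            ≡⟨ cong₂ _++_ (filter-all P? in-R) (filter-none P? out-Z) ⟩
      R ++ []                               ≡⟨ ++-identityʳ R ⟩
      R ∎

module Blocks {N π} (perm : IsPerm N π) (dumont : DumontCond π) where

  open Permutation perm

  suffix-min-odd : ∀ U {R x} → π ≡ U ++ R → x ∈ R → All (x ≤_) R → Odd x
  suffix-min-odd U π≡UR x∈R above with R₁ , R₂ , refl , above-R₂ ← split-at above x∈R =
    odd-if-followed-by-larger (U ++ R₁)
      (subst DumontCond (trans π≡UR (sym (++-assoc U R₁ _))) dumont) above-R₂

  suffix-max-even : ∀ U {R o x} → π ≡ U ++ R ++ [ o ] → x ∈ R → All (_≤ x) R → o ≤ x → Even x
  suffix-max-even U {o = o} π≡URo x∈R below o≤x with R₁ , R₂ , refl , below-R₂ ← split-at below x∈R =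
    even-if-followed-by-smaller (U ++ R₁) R₂
      (subst DumontCond (trans π≡URo (trans (cong (U ++_) (++-assoc R₁ _ [ o ])) (sym (++-assoc U R₁ _)))) dumont)
      below-R₂ o≤x

  segment-bounds : ∀ U {r R Z} → π ≡ U ++ (r ∷ R) ++ Z →
    ∃₂ λ a d → suc a ∈ r ∷ R × d ∈ r ∷ R × All (Between a d) (r ∷ R)
  segment-bounds U {r} {R} π≡ with extremes r R
  ... | suc a , d , min∈ , max∈ , bounds = a , d , min∈ , max∈ , bounds
  ... | zero , _ , min∈ , _ = ⊥-elim (<-irrefl refl (proj₁ (∈-bounded U π≡ (∈-++⁺ˡ min∈))))

  ascending-block : ∀ {U R Z a d} → π ≡ U ++ R ++ Z → suc a ∈ R → d ∈ R → All (Between a d) R →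
    All (λ u → u ≤ a ⊎ suc d < u) U → All (d <_) Z → d < N → Even (length R)
  ascending-block {U} {R} {Z} {a} {d} π≡URZ min∈R max∈R in-R out-U above-Z d<N =
    even-difference even-a even-d
      (block-length π≡URZ in-R (All.map outside-U out-U) (All.map (λ d<z (_ , z≤d) → <⇒≱ d<z z≤d) above-Z)
        (<⇒≤ a<d) (<⇒≤ d<N))
    where
    a<d : a < d
    a<d = proj₂ (All.lookup in-R min∈R)
    outside-U : ∀ {u} → u ≤ a ⊎ suc d < u → ¬ Between a d u
    outside-U (inj₁ u≤a) (a<u , _) = <⇒≱ a<u u≤a
    outside-U (inj₂ d+1<u) (_ , u≤d) = <⇒≱ (<-trans (n<1+n d) d+1<u) u≤d
    even-a : Even a
    even-a = odd-suc⇒even (suffix-min-odd U π≡URZ (∈-++⁺ˡ min∈R)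
      (All-++⁺ (All.map proj₁ in-R) (All.map (<-trans a<d) above-Z)))
    even-d : Even d
    even-d with ∈-++⁻ U (subst (suc d ∈_) π≡URZ (entry-∈ z<s d<N))
    ... | inj₁ ∈U with All.lookup out-U ∈U
    ...   | inj₁ d+1≤a = ⊥-elim (<-asym a<d d+1≤a)
    ...   | inj₂ d+1<d+1 = ⊥-elim (<-irrefl refl d+1<d+1)
    even-d | inj₂ ∈RZ with ∈-++⁻ R ∈RZ
    ...   | inj₁ ∈R = ⊥-elim (<-irrefl refl (proj₂ (All.lookup in-R ∈R)))
    ...   | inj₂ ∈Z = odd-suc⇒even (suffix-min-odd (U ++ R) (trans π≡URZ (sym (++-assoc U R Z))) ∈Z above-Z)

  descending-block : ∀ {U R Z o a d} → π ≡ U ++ R ++ Z ++ [ o ] → suc a ∈ R → d ∈ R → All (Between a d) R →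
    All (λ u → u < a ⊎ d < u) U → All (_≤ a) Z → o < a → Even (length R)
  descending-block {U} {R} {Z} {o} {a} {d} π≡URZo min∈R max∈R in-R out-U below-Z o<a =
    even-difference even-a even-d
      (block-length π≡URZo in-R (All.map outside-U out-U)
        (All-++⁺ (All.map (λ z≤a (a<z , _) → <⇒≱ a<z z≤a) below-Z) ((λ (a<o , _) → <-asym a<o o<a) ∷ []))
        (<⇒≤ a<d) d≤N)
    where
    a<d : a < d
    a<d = proj₂ (All.lookup in-R min∈R)
    d≤N : d ≤ N
    d≤N = proj₂ (∈-bounded U π≡URZo (∈-++⁺ˡ max∈R))
    outside-U : ∀ {u} → u < a ⊎ d < u → ¬ Between a d u
    outside-U (inj₁ u<a) (a<u , _) = <-asym a<u u<a
    outside-U (inj₂ d<u) (_ , u≤d) = <⇒≱ d<u u≤d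
    even-d : Even d
    even-d = suffix-max-even U (trans π≡URZo (cong (U ++_) (sym (++-assoc R Z [ o ]))))
      (∈-++⁺ˡ max∈R) (All-++⁺ (All.map proj₂ in-R) (All.map (λ z≤a → ≤-trans z≤a (<⇒≤ a<d)) below-Z))
      (<⇒≤ (<-trans o<a a<d))
    even-a : Even a
    even-a with ∈-++⁻ U (subst (a ∈_) π≡URZo (entry-∈ (≤-<-trans z≤n o<a) (≤-trans (<⇒≤ a<d) d≤N)))
    ... | inj₁ ∈U with All.lookup out-U ∈U
    ...   | inj₁ a<a = ⊥-elim (<-irrefl refl a<a)
    ...   | inj₂ d<a = ⊥-elim (<-asym a<d d<a)
    even-a | inj₂ ∈RZo with ∈-++⁻ R ∈RZo
    ...   | inj₁ ∈R = ⊥-elim (<-irrefl refl (proj₁ (All.lookup in-R ∈R)))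
    ...   | inj₂ ∈Zo with ∈-++⁻ Z ∈Zo
    ...     | inj₁ ∈Z = suffix-max-even (U ++ R) (trans π≡URZo (sym (++-assoc U R _))) ∈Z below-Z (<⇒≤ o<a)
    ...     | inj₂ (here refl) = ⊥-elim (<-irrefl refl o<a)

module LastEntry {N π} (perm : IsPerm N π) (dumont : DumontCond π)
  (no-2413 : ¬ Contains2413 π) (no-3142 : ¬ Contains3142 π)
  {O} (even-E : Even (suc O)) {P A₀} (π≡PEA₀O : π ≡ P ++ suc O ∷ A₀ ++ [ O ]) where

  open Permutation perm
  open Blocks perm dumont

  E : ℕ
  E = suc O

  O<E : O < E
  O<E = ≤-refl

  distinct-mid : ∀ {X Y Z y z} → π ≡ X ++ Y ++ Z → y ∈ Y → z ∈ Z → y ≢ z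
  distinct-mid {X} {Y} {Z} π≡XYZ y∈Y = entries-distinct (trans π≡XYZ (sym (++-assoc X Y Z))) (∈-++⁺ʳ X y∈Y)

  O≤N : O ≤ N
  O≤N = proj₂ (∈-bounded (P ++ E ∷ A₀) (trans π≡PEA₀O (sym (++-assoc P (E ∷ A₀) [ O ]))) (here refl))

  small-block-left : ∀ {U R Z a d} → π ≡ U ++ R ++ Z → LastSatisfies (O <_) U →
    suc a ∈ R → d < O → O ∈ Z → All (λ u → u ≤ a ⊎ suc d < u) U
  small-block-left _ (inj₁ refl) _ _ _ = []
  small-block-left {R = R} {Z} {a} {d} π≡ (inj₂ (U′ , b , refl , O<b)) c∈R d<O O∈Z =
    All-++⁺ (All.tabulate classify) (inj₂ (≤-<-trans d<O O<b) ∷ [])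
    where
    classify : ∀ {u} → u ∈ U′ → u ≤ a ⊎ suc d < u
    classify {u} u∈U′ with ≢⇒<⊎> (entries-distinct π≡ (∈-++⁺ˡ u∈U′) (∈-++⁺ˡ c∈R))
    ... | inj₁ u<c = inj₁ (≤-pred u<c)
    ... | inj₂ c<u with ≢⇒<⊎> (entries-distinct π≡ (∈-++⁺ˡ u∈U′) (∈-++⁺ʳ R O∈Z))
    ...   | inj₂ O<u = inj₂ (≤-<-trans d<O O<u)
    ...   | inj₁ u<O = ⊥-elim (no-2413 (u , b , suc a , O ,
            four-segments-⊆ U′ [ b ] R Z (trans π≡ (++-assoc U′ [ b ] (R ++ Z))) u∈U′ (here refl) c∈R O∈Z , c<u , u<O , O<b))

  small-block-right : ∀ {X W d} → π ≡ X ++ W ++ [ O ] → HeadSatisfies (O <_) W →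
    d ∈ X → d < O → All (d <_) (W ++ [ O ])
  small-block-right _ (inj₁ refl) _ d<O = d<O ∷ []
  small-block-right {X} {d = d} π≡ (inj₂ (b , W′ , refl , O<b)) d∈X d<O =
    <-trans d<O O<b ∷ All-++⁺ (All.tabulate classify) (d<O ∷ [])
    where
    classify : ∀ {w} → w ∈ W′ → d < w
    classify {w} w∈W′ with ≢⇒<⊎> (entries-distinct π≡ d∈X (there (∈-++⁺ˡ w∈W′)))
    ... | inj₁ d<w = d<w
    ... | inj₂ w<d = ⊥-elim (no-2413 (d , b , w , O ,
          four-segments-⊆ X [ b ] W′ [ O ] π≡ d∈X (here refl) w∈W′ (here refl) , w<d , d<O , O<b))

  small-block : ∀ U {r R W} → π ≡ U ++ (r ∷ R) ++ W ++ [ O ] → All (_< O) (r ∷ R) →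
    LastSatisfies (O <_) U → HeadSatisfies (O <_) W → Even (length (r ∷ R))
  small-block U {r} {R} {W} π≡ below-O last-U head-W with segment-bounds U π≡
  ... | a , d , min∈ , max∈ , in-R =
    ascending-block π≡ min∈ max∈ in-R
      (small-block-left π≡ last-U min∈ d<O (∈-++⁺ʳ W (here refl)))
      (small-block-right (trans π≡ (sym (++-assoc U (r ∷ R) _))) head-W (∈-++⁺ʳ U max∈) d<O)
      (<-≤-trans d<O O≤N)
    where
    d<O : d < O
    d<O = All.lookup below-O max∈

  big-block-left : ∀ {U R Z a d} → π ≡ U ++ R ++ Z → LastSatisfies (_< O) U →
    d ∈ R → E ≤ a → E ∈ Z → All (λ u → u < a ⊎ d < u) U
  big-block-left _ (inj₁ refl) _ _ _ = []
  big-block-left {R = R} {Z} {a} {d} π≡ (inj₂ (U′ , s , refl , s<O)) d∈R E≤a E∈Z =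
    All-++⁺ (All.tabulate classify) (inj₁ (<-≤-trans (<-trans s<O O<E) E≤a) ∷ [])
    where
    classify : ∀ {u} → u ∈ U′ → u < a ⊎ d < u
    classify {u} u∈U′ with ≢⇒<⊎> (entries-distinct π≡ (∈-++⁺ˡ u∈U′) (∈-++⁺ʳ R E∈Z))
    ... | inj₁ u<E = inj₁ (<-≤-trans u<E E≤a)
    ... | inj₂ E<u with ≢⇒<⊎> (entries-distinct π≡ (∈-++⁺ˡ u∈U′) (∈-++⁺ˡ d∈R))
    ...   | inj₂ d<u = inj₂ d<u
    ...   | inj₁ u<d = ⊥-elim (no-3142 (u , s , d , E ,
            four-segments-⊆ U′ [ s ] R Z (trans π≡ (++-assoc U′ [ s ] (R ++ Z))) u∈U′ (here refl) d∈R E∈Z ,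
            <-trans s<O O<E , E<u , u<d))

  big-block-right : ∀ {X V T c} → π ≡ X ++ V ++ E ∷ T → HeadSatisfies (_< O) V →
    c ∈ X → E < c → All (_< c) V
  big-block-right _ (inj₁ refl) _ _ = []
  big-block-right {X} {T = T} {c} π≡ (inj₂ (s , V′ , refl , s<O)) c∈X E<c =
    <-trans s<O (<-trans O<E E<c) ∷ All.tabulate classify
    where
    classify : ∀ {v} → v ∈ V′ → v < c
    classify {v} v∈V′ with ≢⇒<⊎> (entries-distinct π≡ c∈X (there (∈-++⁺ˡ v∈V′)))
    ... | inj₂ v<c = v<c
    ... | inj₁ c<v = ⊥-elim (no-3142 (c , s , v , E ,
          four-segments-⊆ X [ s ] V′ (E ∷ T) π≡ c∈X (here refl) v∈V′ (here refl) ,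
          <-trans s<O O<E , E<c , c<v))

  big-block : ∀ U {r R V T} → π ≡ U ++ (r ∷ R) ++ (V ++ E ∷ T) ++ [ O ] → All (E <_) (r ∷ R) →
    LastSatisfies (_< O) U → HeadSatisfies (_< O) V → All (_< O) T → Even (length (r ∷ R))
  big-block U {r} {R} {V} {T} π≡ above-E last-U head-V below-T with segment-bounds U π≡
  ... | a , d , min∈ , max∈ , in-R =
    descending-block π≡ min∈ max∈ in-R
      (big-block-left π≡ last-U max∈ E≤a (∈-++⁺ˡ (∈-++⁺ʳ V (here refl))))
      (All.map ≤-pred (All-++⁺ (big-block-right π≡′ head-V (∈-++⁺ʳ U min∈) E<c)
                               (E<c ∷ All.map (λ t<O → <-trans t<O (<-trans O<E E<c)) below-T)))
      (<-≤-trans O<E E≤a)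
    where
    E<c : E < suc a
    E<c = All.lookup above-E min∈
    E≤a : E ≤ a
    E≤a = ≤-pred E<c
    π≡′ : π ≡ (U ++ r ∷ R) ++ V ++ E ∷ T ++ [ O ]
    π≡′ = trans π≡ (trans (cong (λ Z → U ++ (r ∷ R) ++ Z) (++-assoc V (E ∷ T) [ O ])) (sym (++-assoc U (r ∷ R) _)))

  after-E-below-O : ∀ X T → π ≡ X ++ E ∷ T ++ [ O ] → All (_< O) T
  after-E-below-O X [] _ = []
  after-E-below-O X (t ∷ T) π≡ = t<O ∷ All.tabulate classify
    where
    t<O : t < O
    t<O = ≤∧≢⇒< (≤-pred (proj₁ (dumont-step X (subst DumontCond π≡ dumont)) even-E))
                (distinct-mid {X} {E ∷ t ∷ T} π≡ (there (here refl)) (here refl))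
    classify : ∀ {y} → y ∈ T → y < O
    classify {y} y∈T with ≢⇒<⊎> (distinct-mid {X} {E ∷ t ∷ T} π≡ (there (there y∈T)) (here refl))
    ... | inj₁ y<O = y<O
    ... | inj₂ E≤y = ⊥-elim (no-3142 (E , t , y , O ,
          four-segments-⊆ (X ++ [ E ]) [ t ] T [ O ] (trans π≡ (sym (++-assoc X [ E ] _)))
            (∈-++⁺ʳ X (here refl)) (here refl) y∈T (here refl) ,
          t<O , O<E , ≤∧≢⇒< E≤y (distinct-mid {X} {[ E ]} π≡ (here refl) (there (∈-++⁺ˡ y∈T)))))

  after-E-even : ∀ X T → π ≡ X ++ E ∷ T ++ [ O ] → Even (length T)
  after-E-even X [] _ = divides 0 refl
  after-E-even X (t ∷ T) π≡ =
    small-block (X ++ [ E ]) {W = []} (trans π≡ (sym (++-assoc X [ E ] _)))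
      (after-E-below-O X (t ∷ T) π≡) (inj₂ (X , E , refl , O<E)) (inj₁ refl)

  OffBoundary : ℕ → Set
  OffBoundary x = x < O ⊎ E < x

  prefix-off-boundary : All OffBoundary P
  prefix-off-boundary = All.tabulate classify
    where
    classify : ∀ {x} → x ∈ P → OffBoundary x
    classify x∈P with ≢⇒<⊎> (entries-distinct π≡PEA₀O x∈P (there (∈-++⁺ʳ A₀ (here refl))))
    ... | inj₁ x<O = inj₁ x<O
    ... | inj₂ E≤x = inj₂ (≤∧≢⇒< E≤x (≢-sym (entries-distinct π≡PEA₀O x∈P (here refl))))

  above-E : ∀ {x} → OffBoundary x → (x <ᵇ O) ≡ false → E < x
  above-E (inj₁ x<O) x≮O = ⊥-elim (<ᵇ-false x≮O x<O)
  above-E (inj₂ E<x) _ = E<x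

  prefix-segment : ∀ U R V → P ≡ U ++ R ++ V → π ≡ U ++ R ++ (V ++ E ∷ A₀) ++ [ O ]
  prefix-segment U R V P≡URV = begin
    π                                     ≡⟨ π≡PEA₀O ⟩
    P ++ E ∷ A₀ ++ [ O ]                  ≡⟨ cong (_++ E ∷ A₀ ++ [ O ]) P≡URV ⟩
    (U ++ R ++ V) ++ E ∷ A₀ ++ [ O ]      ≡⟨ ++-assoc U (R ++ V) _ ⟩
    U ++ (R ++ V) ++ E ∷ A₀ ++ [ O ]      ≡⟨ cong (U ++_) (++-assoc R V _) ⟩
    U ++ R ++ V ++ E ∷ A₀ ++ [ O ]        ≡⟨ cong (λ Z → U ++ R ++ Z) (++-assoc V (E ∷ A₀) [ O ]) ⟨
    U ++ R ++ (V ++ E ∷ A₀) ++ [ O ]      ∎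
    where open ≡-Reasoning

  prefix-run-even : ∀ {R} → Run (_<ᵇ O) P R → Even (length R)
  prefix-run-even {[]} _ = divides 0 refl
  prefix-run-even {r ∷ R} (run true U V P≡URV below-O last-U head-V) =
    small-block U (prefix-segment U (r ∷ R) V P≡URV) (All.map <ᵇ-true below-O)
      (LastSatisfies-map (λ u∈U → <-trans O<E ∘ above-E (All.lookup (++⁻ˡ U off) u∈U)) last-U)
      (HeadSatisfies-++ A₀ (HeadSatisfies-map (λ v∈V → <-trans O<E ∘ above-E (All.lookup off-V v∈V)) head-V) O<E)
    where
    off : All OffBoundary (U ++ (r ∷ R) ++ V)
    off = subst (All OffBoundary) P≡URV prefix-off-boundary
    off-V : All OffBoundary V
    off-V = ++⁻ʳ (r ∷ R) (++⁻ʳ U off)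
  prefix-run-even {r ∷ R} (run false U V P≡URV not-below-O last-U head-V) =
    big-block U (prefix-segment U (r ∷ R) V P≡URV)
      (All.zipWith (λ (off-x , px) → above-E off-x px) (off-R , not-below-O))
      (LastSatisfies-map (λ _ → <ᵇ-true) last-U) (HeadSatisfies-map (λ _ → <ᵇ-true) head-V)
      (after-E-below-O P A₀ π≡PEA₀O)
    where
    off-R : All OffBoundary (r ∷ R)
    off-R = ++⁻ˡ (r ∷ R) (++⁻ʳ U (subst (All OffBoundary) P≡URV prefix-off-boundary))

lemma3 : (n k : ℕ) → 1 ≤ n → (π P A₀ : List ℕ) → InD n π →
    π ≡ P ++ (2 * k ∷ A₀ ++ (2 * k ∸ 1 ∷ [])) →
    Even (length A₀) × All (λ R → Even (length R)) (prefixBlocks k P)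
lemma3 n zero _ π P A₀ ((perm , _) , _) π≡ =
  ⊥-elim (<-irrefl refl (proj₁ (Permutation.∈-bounded perm P π≡ (here refl))))
-- 2 * suc j reduces to suc (2 * suc j ∸ 1), so π≡ already has the shape LastEntry expects.
lemma3 n (suc j) _ π P A₀ ((perm , dumont) , no-2413 , no-3142) π≡ =
  after-E-even P A₀ π≡ , All.map prefix-run-even (runs-Run _ P)
  where open LastEntry perm dumont no-2413 no-3142 (divides (suc j) (*-comm 2 (suc j))) π≡
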